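{- Let $\chi$ and $\check\phi$ be formulas over $\vec{x}$ and $\vec{a}:\mathbb{Z}^d\to\mathbb{Z}^d$ such that for all $\vec{x}\in\mathbb{Z}^d$: $\check\phi(\vec{x})\land\chi(\vec{x})\implies\chi(\vec{a}(\vec{x}))$. Then the conditional acceleration technique $(\langle\chi,\vec{a}\rangle,\check\phi)\mapsto \vec{x}'=\vec{a}^n(\vec{x})\land\chi(\vec{x})$ (defined on all such pairs) is exact. Explicitly: for all $\vec{x},\vec{x}'\in\mathbb{Z}^d$ and $n>0$, (i) if $\vec{x}\longrightarrow^n_{\langle\check\phi,\vec{a}\rangle}\vec{x}'$, $\vec{x}'=\vec{a}^n(\vec{x})$ and $\chi(\vec{x})$, then $\vec{x}\longrightarrow^n_{\langle\chi,\vec{a}\rangle}\vec{x}'$; and (ii) if $\vec{x}\longrightarrow^n_{\langle\chi\land\check\phi,\vec{a}\rangle}\vec{x}'$, then $\vec{x}'=\vec{a}^n(\vec{x})$ and $\chi(\vec{x})$.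
   Context: $\vec{x}=(x_1,\dots,x_d)$ ranges over $\mathbb{Z}^d$, $n$ is a variable, $\vec{x}'=(x_1',\dots,x_d')$. Formulas are finite quantifier-free propositional formulas with atoms $p>0$, $p$ a closed-form arithmetic expression. For a formula $\phi$ over $\vec{x}$ and $\vec{a}:\mathbb{Z}^d\to\mathbb{Z}^d$, the loop $\langle\phi,\vec{a}\rangle$ induces $\vec{x}\longrightarrow_{\langle\phi,\vec{a}\rangle}\vec{x}'$ iff $\phi(\vec{x})\land\vec{x}'=\vec{a}(\vec{x})$; $\longrightarrow^n$ is its $n$-fold composition, and $\vec{a}^n$ is the $n$-fold application of $\vec{a}$ ($\vec{a}^0=\mathrm{id}$). A conditional acceleration technique is a partial function $\mathit{accel}$ mapping pairs (loop $\langle\chi,\vec{a}\rangle$, formula $\check\phi$) to formulas over $(\vec{x},n,\vec{x}')$; it is sound if for all arguments in its domain, $\vec{x},\vec{x}'\in\mathbb{Z}^d$, $n>0$: $\vec{x}\longrightarrow^n_{\langle\check\phi,\vec{a}\rangle}\vec{x}'\land\mathit{accel}(\langle\chi,\vec{a}\rangle,\check\phi)$ implies $\vec{x}\longrightarrow^n_{\langle\chi,\vec{a}\rangle}\vec{x}'$; exact if additionally $\vec{x}\longrightarrow^n_{\langle\chi\land\check\phi,\vec{a}\rangle}\vec{x}'$ implies $\mathit{accel}(\langle\chi,\vec{a}\rangle,\check\phi)$. -}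

module Defs where

open import Level using (Level; suc; _⊔_)
open import Data.Nat using (ℕ; zero; suc; _>_)
open import Data.Integer using (ℤ)
open import Data.Vec using (Vec)
open import Data.Product using (_×_; ∃-syntax; Σ-syntax)
open import Relation.Binary.PropositionalEquality using (_≡_)

Pt : ℕ → Set
Pt d = Vec ℤ d

-- A formula over x⃗, represented semantically by the set of its models.
Formula : ℕ → Set₁
Formula d = Pt d → Set

Formula₃ : ℕ → Set₁
Formula₃ d = Pt d → ℕ → Pt d → Set

_∧ᶠ_ : ∀ {d} → Formula d → Formula d → Formula d
(φ ∧ᶠ ψ) x = φ x × ψ x

record Loop (d : ℕ) : Set₁ where
  constructor ⟨_,_⟩
  field
    guard  : Formula d
    update : Pt d → Pt d
open Loop public

Step : ∀ {d} → Loop d → Pt d → Pt d → Set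
Step L x x' = guard L x × x' ≡ update L x

Steps : ∀ {d} → Loop d → ℕ → Pt d → Pt d → Set
Steps L zero    x x' = x ≡ x'
Steps L (suc n) x x' = ∃[ y ] (Step L x y × Steps L n y x')

iter : ∀ {d} → (Pt d → Pt d) → ℕ → Pt d → Pt d
iter a zero    x = x
iter a (suc n) x = iter a n (a x)

-- A conditional acceleration technique: a partial function, given by its
-- domain predicate together with the function on that domain.
record AccelTechnique (d : ℕ) : Set₂ where
  field
    Dom   : Loop d → Formula d → Set
    accel : (L : Loop d) (φ̌ : Formula d) → Dom L φ̌ → Formula₃ d
open AccelTechnique public

Sound : ∀ {d} → AccelTechnique d → Set₁
Sound {d} T =
  ∀ (L : Loop d) (φ̌ : Formula d) (dom : Dom T L φ̌) (x x' : Pt d) (n : ℕ) → n > 0 →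
    Steps ⟨ φ̌ , update L ⟩ n x x' → accel T L φ̌ dom x n x' →
    Steps L n x x'

Exact : ∀ {d} → AccelTechnique d → Set₁
Exact {d} T =
  Sound T ×
  (∀ (L : Loop d) (φ̌ : Formula d) (dom : Dom T L φ̌) (x x' : Pt d) (n : ℕ) → n > 0 →
    Steps ⟨ guard L ∧ᶠ φ̌ , update L ⟩ n x x' → accel T L φ̌ dom x n x')

accel-thm8 : (d : ℕ) → AccelTechnique d
accel-thm8 d = record
  { Dom   = λ L φ̌ → ∀ (x : Pt d) → φ̌ x → guard L x → guard L (update L x)
  ; accel = λ L φ̌ _ x n x' → x' ≡ iter (update L) n x × guard L x
  }

-- Soundness: χ(x) starts the run, and along a ⟨φ̌, a⃗⟩-run every step satisfies φ̌, so the
-- premise φ̌ ∧ χ ⟹ χ ∘ a⃗ propagates χ to every intermediate state. Exactness: any run of a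
-- loop ends at a⃗ⁿ(x), and a nonempty ⟨χ ∧ φ̌, a⃗⟩-run has χ at its first state.
module Submission where

open import Defs
open import Data.Nat using (ℕ; zero; suc; s≤s; _>_)
open import Data.Product using (_,_; proj₁)
open import Relation.Binary.PropositionalEquality using (_≡_; refl; sym)

Steps⇒≡iter : ∀ {d} (L : Loop d) n {x x'} → Steps L n x x' → x' ≡ iter (update L) n x
Steps⇒≡iter L zero    x≡x'                 = sym x≡x'
Steps⇒≡iter L (suc n) (y , (_ , refl) , r) = Steps⇒≡iter L n r

Steps-suc⇒guard : ∀ {d} (L : Loop d) n {x x'} → Steps L (suc n) x x' → guard L x
Steps-suc⇒guard L n (_ , (g , _) , _) = g

Steps-strengthen : ∀ {d} {ψ χ : Formula d} {a : Pt d → Pt d} →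
                   (∀ x → ψ x → χ x → χ (a x)) →
                   ∀ n {x x'} → Steps ⟨ ψ , a ⟩ n x x' → χ x → Steps ⟨ χ , a ⟩ n x x'
Steps-strengthen inv zero    x≡x'                 _  = x≡x'
Steps-strengthen inv (suc n) (y , (p , refl) , r) χx =
  y , (χx , refl) , Steps-strengthen inv n r (inv _ p χx)

theorem8 : (d : ℕ) → Exact (accel-thm8 d)
theorem8 d = sound , complete
  where
  sound : Sound (accel-thm8 d)
  sound L φ̌ inv x x' n _ run (_ , χx) = Steps-strengthen inv n run χx

  complete : ∀ (L : Loop d) (φ̌ : Formula d) (inv : Dom (accel-thm8 d) L φ̌) (x x' : Pt d) n →
             n > 0 → Steps ⟨ guard L ∧ᶠ φ̌ , update L ⟩ n x x' → accel (accel-thm8 d) L φ̌ inv x n x'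
  complete L φ̌ _ x x' (suc n) (s≤s _) run =
    Steps⇒≡iter _ (suc n) run , proj₁ (Steps-suc⇒guard _ n run)
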